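{- For every $n\ge 1$ there is a bijection between $\mathcal{RS}_n(231)$ and $\mathcal{RS}_n(213)$.
   Context: For $\sigma\in\mathfrak{S}_n$, a double descent is an index $i$ with $\sigma_i>\sigma_{i+1}>\sigma_{i+2}$. The permutation $\sigma$ is simsun if for every $k$, the subword of $\sigma$ consisting of the letters in $\{1,\dots,k\}$ (in the order they appear in $\sigma$) has no double descent. For $\omega\in\mathfrak{S}_t$, $\sigma$ contains an $\omega$-pattern if there are indices $i_1<\cdots<i_t$ with $\sigma_{i_j}<\sigma_{i_k}$ iff $\omega_j<\omega_k$; otherwise $\sigma$ avoids $\omega$. $\mathcal{RS}_n(\omega)$ is the set of $\omega$-avoiding simsun permutations in $\mathfrak{S}_n$. -}

module Defs where

open import Data.Nat using (ℕ; zero; suc; _<_; _≤_; _>_)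
open import Data.List using (List; []; _∷_; filter; upTo; length; lookup)
open import Data.List.Relation.Binary.Sublist.Propositional using (_⊆_)
open import Data.List.Relation.Binary.Permutation.Propositional using (_↭_)
open import Data.Fin using (Fin)
open import Data.Product using (Σ; ∃; _×_; _,_)
open import Relation.Nullary using (¬_)
open import Relation.Unary using (Pred)
open import Relation.Binary.PropositionalEquality using (_≡_)
open import Data.Nat.Properties using (_<?_)
open import Level using (0ℓ)

-- A permutation of [n] is represented by its one-line notation as a word
-- (list of naturals) that is a rearrangement of 0,1,…,n-1
-- (values shifted down by one; only relative order matters below).
IsPerm : ℕ → List ℕ → Set
IsPerm n w = w ↭ upTo n

data HasDoubleDescent : List ℕ → Set where
  here  : ∀ {a b c rest} → a > b → b > c → HasDoubleDescent (a ∷ b ∷ c ∷ rest)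
  there : ∀ {a rest} → HasDoubleDescent rest → HasDoubleDescent (a ∷ rest)

-- subword of letters with value < k (i.e. letters in {1,…,k} in 1-based values)
restrict : ℕ → List ℕ → List ℕ
restrict k w = filter (_<? k) w

Simsun : List ℕ → Set
Simsun w = ∀ k → ¬ HasDoubleDescent (restrict k w)

OrderIso : List ℕ → List ℕ → Set
OrderIso u v = Σ (length u ≡ length v) λ eq →
  ∀ (i j : Fin (length u)) →
    (lookup u i < lookup u j → lookup v (Data.Fin.cast eq i) < lookup v (Data.Fin.cast eq j))
    × (lookup v (Data.Fin.cast eq i) < lookup v (Data.Fin.cast eq j) → lookup u i < lookup u j)

Contains : List ℕ → List ℕ → Set
Contains ω w = ∃ λ u → u ⊆ w × OrderIso u ω

Avoids : List ℕ → List ℕ → Set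
Avoids ω w = ¬ Contains ω w

RS : ℕ → List ℕ → Pred (List ℕ) 0ℓ
RS n ω w = IsPerm n w × Simsun w × Avoids ω w

Bijection : Pred (List ℕ) 0ℓ → Pred (List ℕ) 0ℓ → Set
Bijection P Q = Σ (List ℕ → List ℕ) λ f → Σ (List ℕ → List ℕ) λ g →
  (∀ w → P w → Q (f w) × g (f w) ≡ w) ×
  (∀ w → Q w → P (g w) × f (g w) ≡ w)

-- Both classes are coded by the same objects: unary-binary trees with n letters (a unary
-- node counts one letter, a binary node two).  Reading a permutation at its least letter lo:
--   * a 231-avoiding simsun word is lo ∷ w′, or x ∷ lo ∷ L ++ H, where L holds the letters
--     between lo and x and H those above x (two letters in front of lo would form a 231 with
--     lo or a double descent);
--   * a 213-avoiding simsun word is lo ∷ w′, or A ++ lo ∷ B, where A holds the top letters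
--     and is a nonempty block none of whose restrictions ends in a descent.
module Submission where

open import Defs
open import Data.Fin using (zero; suc)
open import Data.Nat using (ℕ; zero; suc; _+_; _∸_; _<_; _≤_; _≥_; z≤n; s≤s; _<?_; _≤?_; _≟_)
open import Data.Nat.Properties
open import Data.List using (List; []; _∷_; _++_; length; filter; upTo; applyUpTo; take; drop)
open import Data.List.Properties using (filter-all; filter-none; filter-++; filter-accept; filter-reject; ++-identityʳ; ∷-injective; length-++-≤ˡ; length-++-≤ʳ)
open import Data.List.Extrema.Nat using (max; xs≤max; v≤max⁺; argmax-sel)
open import Data.List.Relation.Unary.All as All using (All; []; _∷_)
import Data.List.Relation.Unary.All.Properties as All
open import Data.List.Relation.Unary.Any using (here; there)
open import Data.List.Relation.Unary.AllPairs using ([]; _∷_)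
open import Data.List.Relation.Unary.Unique.Propositional using (Unique)
open import Data.List.Membership.Propositional using (_∈_; _∉_)
open import Data.List.Membership.Propositional.Properties using (∈-++⁺ˡ; ∈-++⁺ʳ; ∈-++⁻)
open import Data.List.Relation.Binary.Sublist.Propositional using (_⊆_; []; _∷_; _∷ʳ_; ⊆-refl; ⊆-trans; minimum; from∈)
import Data.List.Relation.Binary.Sublist.Propositional as Sublist
import Data.List.Relation.Binary.Sublist.Propositional.Properties as Sublist
open import Data.List.Relation.Binary.Permutation.Propositional using (_↭_; module PermutationReasoning; ↭-sym; ↭-trans; ↭-refl; prep; swap; ↭⇒↭ₛ)
open import Data.List.Relation.Binary.Permutation.Propositional.Properties using (∈-resp-↭; ↭-length; drop-∷; filter-↭; shift; ++-comm; ++⁺)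
open import Data.List.Relation.Binary.Permutation.Setoid.Properties using (Unique-resp-↭)
open import Data.Maybe using (Maybe; just; nothing)
import Data.Maybe as Maybe
open import Data.Product using (Σ; _×_; _,_; proj₁; proj₂)
import Data.Product as Product
open import Data.Sum using (_⊎_; inj₁; inj₂)
open import Data.Empty using (⊥; ⊥-elim)
open import Relation.Nullary using (¬_; yes; no)
open import Relation.Unary using (Pred)
open import Level using (0ℓ)
open import Relation.Binary using (tri<; tri≈; tri>)
open import Relation.Binary.PropositionalEquality using (_≡_; _≢_; refl; sym; trans; cong; cong₂; subst; subst₂; setoid; module ≡-Reasoning)

<-irr : ∀ {m} → m < m → ⊥
<-irr = <-irrefl refl

-- The range lo, lo+1, …, lo+n-1, built so that it unfolds from its least element.
range : ℕ → ℕ → List ℕ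
range lo zero    = []
range lo (suc n) = lo ∷ range (suc lo) n

upTo≡range : ∀ n → upTo n ≡ range 0 n
upTo≡range n = shifted (λ i → i) 0 n (λ i → refl)
  where
  shifted : ∀ (f : ℕ → ℕ) lo n → (∀ i → f i ≡ lo + i) → applyUpTo f n ≡ range lo n
  shifted f lo zero    f≗ = refl
  shifted f lo (suc n) f≗ = cong₂ _∷_ (trans (f≗ 0) (+-identityʳ lo))
    (shifted (λ i → f (suc i)) (suc lo) n (λ i → trans (f≗ (suc i)) (+-suc lo i)))

length-range : ∀ lo n → length (range lo n) ≡ n
length-range lo zero    = refl
length-range lo (suc n) = cong suc (length-range (suc lo) n)

∈-range⁻ : ∀ {v} lo n → v ∈ range lo n → lo ≤ v × v < lo + n
∈-range⁻ lo (suc n) (here refl) = ≤-refl , subst (lo <_) (sym (+-suc lo n)) (s≤s (m≤m+n lo n))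
∈-range⁻ {v} lo (suc n) (there p) with ∈-range⁻ (suc lo) n p
... | lo<v , v<end = <⇒≤ lo<v , subst (v <_) (sym (+-suc lo n)) v<end

range-++ : ∀ lo k j → range lo (k + j) ≡ range lo k ++ range (lo + k) j
range-++ lo zero    j = cong (λ s → range s j) (sym (+-identityʳ lo))
range-++ lo (suc k) j = cong (lo ∷_) (trans (range-++ (suc lo) k j) (cong (λ s → range (suc lo) k ++ range s j) (sym (+-suc lo k))))

range-cut : ∀ lo n c → lo ≤ c → c ≤ lo + n → range lo n ≡ range lo (c ∸ lo) ++ range c (n ∸ (c ∸ lo))
range-cut lo n c lo≤c c≤end = begin
  range lo n                                          ≡⟨ cong (range lo) (sym (m+[n∸m]≡n k≤n)) ⟩
  range lo (k + (n ∸ k))                              ≡⟨ range-++ lo k (n ∸ k) ⟩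
  range lo k ++ range (lo + k) (n ∸ k)                ≡⟨ cong (λ s → range lo k ++ range s (n ∸ k)) (m+[n∸m]≡n lo≤c) ⟩
  range lo k ++ range c (n ∸ k)                       ∎
  where
  open ≡-Reasoning
  k : ℕ
  k = c ∸ lo
  k≤n : k ≤ n
  k≤n = subst (k ≤_) (m+n∸m≡n lo n) (∸-monoˡ-≤ lo c≤end)

Unique-range : ∀ lo n → Unique (range lo n)
Unique-range lo zero    = []
Unique-range lo (suc n) = All.tabulate (λ v∈ lo≡v → <-irrefl lo≡v (proj₁ (∈-range⁻ (suc lo) n v∈))) ∷ Unique-range (suc lo) n

RangePerm : ℕ → ℕ → List ℕ → Set
RangePerm lo n w = w ↭ range lo n

rangePerm-bounds : ∀ {lo n w} → RangePerm lo n w → All (λ v → lo ≤ v × v < lo + n) w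
rangePerm-bounds {lo} {n} p = All.tabulate (λ v∈w → ∈-range⁻ lo n (∈-resp-↭ p v∈w))

lowerBound : ∀ {lo n w} → RangePerm lo n w → All (lo ≤_) w
lowerBound p = All.map proj₁ (rangePerm-bounds p)

upperBound : ∀ {lo n w} → RangePerm lo n w → All (_< lo + n) w
upperBound p = All.map proj₂ (rangePerm-bounds p)

rangePerm-length : ∀ {lo n w} → RangePerm lo n w → length w ≡ n
rangePerm-length {lo} {n} p = trans (↭-length p) (length-range lo n)

rangePerm-unique : ∀ {lo n w} → RangePerm lo n w → Unique w
rangePerm-unique {lo} {n} p = Unique-resp-↭ (setoid ℕ) (↭⇒↭ₛ (↭-sym p)) (Unique-range lo n)

start∈ : ∀ {lo n w} → RangePerm lo (suc n) w → lo ∈ w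
start∈ p = ∈-resp-↭ (↭-sym p) (here refl)

reindex : ∀ {lo lo′ n w} → lo ≡ lo′ → RangePerm lo n w → RangePerm lo′ (length w) w
reindex refl p = subst (λ m → RangePerm _ m _) (sym (rangePerm-length p)) p

aboveStart : ∀ {lo n} u {v} → RangePerm lo n (u ++ v) → All (_≢ lo) u → All (lo <_) u
aboveStart u p u≢lo = All.tabulate (λ a∈u → ≤∧≢⇒< (All.lookup (lowerBound p) (∈-++⁺ˡ a∈u)) (λ e → All.lookup u≢lo a∈u (sym e)))

rangePerm-head : ∀ {lo n x w} → RangePerm lo (suc n) (x ∷ w) → All (x <_) w → x ≡ lo
rangePerm-head {lo} p x<w with start∈ p | lowerBound p
... | here lo≡x     | _          = sym lo≡x
... | there lo∈w    | lo≤x ∷ _   = ⊥-elim (<-irr (<-≤-trans (All.lookup x<w lo∈w) lo≤x))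

module _ (c : ℕ) {u v : List ℕ} (u<c : All (_< c) u) (c≤v : All (c ≤_) v) where

  filter-below : filter (_<? c) (u ++ v) ≡ u
  filter-below = begin
    filter (_<? c) (u ++ v)                   ≡⟨ filter-++ (_<? c) u v ⟩
    filter (_<? c) u ++ filter (_<? c) v      ≡⟨ cong₂ _++_ (filter-all (_<? c) u<c) (filter-none (_<? c) (All.map (λ c≤a a<c → <-irr (<-≤-trans a<c c≤a)) c≤v)) ⟩
    u ++ []                                   ≡⟨ ++-identityʳ u ⟩
    u                                         ∎
    where open ≡-Reasoning

  filter-above : filter (c ≤?_) (u ++ v) ≡ v
  filter-above = begin
    filter (c ≤?_) (u ++ v)                   ≡⟨ filter-++ (c ≤?_) u v ⟩
    filter (c ≤?_) u ++ filter (c ≤?_) v      ≡⟨ cong₂ _++_ (filter-none (c ≤?_) (All.map (λ a<c c≤a → <-irr (<-≤-trans a<c c≤a)) u<c)) (filter-all (c ≤?_) c≤v) ⟩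
    v                                         ∎
    where open ≡-Reasoning

separate : ∀ c {u v p q} → u ++ v ↭ p ++ q → All (_< c) u → All (c ≤_) v → All (_< c) p → All (c ≤_) q →
  (u ↭ p) × (v ↭ q)
separate c uv↭pq u<c c≤v p<c c≤q =
  subst₂ _↭_ (filter-below c u<c c≤v) (filter-below c p<c c≤q) (filter-↭ (_<? c) uv↭pq) ,
  subst₂ _↭_ (filter-above c u<c c≤v) (filter-above c p<c c≤q) (filter-↭ (c ≤?_) uv↭pq)

rangePerm-split : ∀ {lo n} u v → RangePerm lo n (u ++ v) → (∀ {a b} → a ∈ u → b ∈ v → a < b) →
  RangePerm lo (length u) u × RangePerm (lo + length u) (length v) v
rangePerm-split {lo} [] v p u<v = ↭-refl , reindex (sym (+-identityʳ lo)) p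
rangePerm-split {lo} {n} u@(x ∷ u′) v p u<v = reindex refl low , reindex (trans (sym (m+[n∸m]≡n lo≤c)) (cong (lo +_) (sym (rangePerm-length low)))) high
  where
  -- The maximum m of u; everything in v lies above the cut c = m + 1.
  m c : ℕ
  m = max x u′
  c = suc m
  m∈u : m ∈ u
  m∈u with argmax-sel (λ a → a) x u′
  ... | inj₁ m≡x  = here m≡x
  ... | inj₂ m∈u′ = there m∈u′
  u<c : All (_< c) u
  u<c = s≤s (v≤max⁺ x u′ (inj₁ ≤-refl)) ∷ All.map s≤s (xs≤max x u′)
  c≤v : All (c ≤_) v
  c≤v = All.tabulate (u<v m∈u)
  lo≤c : lo ≤ c
  lo≤c = m≤n⇒m≤1+n (All.lookup (lowerBound p) (∈-++⁺ˡ m∈u))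
  c≤end : c ≤ lo + n
  c≤end = All.lookup (upperBound p) (∈-++⁺ˡ m∈u)
  k : ℕ
  k = c ∸ lo
  parts : (u ↭ range lo k) × (v ↭ range c (n ∸ k))
  parts = separate c (subst (u ++ v ↭_) (range-cut lo n c lo≤c c≤end) p) u<c c≤v
    (All.tabulate (λ {a} a∈ → subst (a <_) (m+[n∸m]≡n lo≤c) (proj₂ (∈-range⁻ lo k a∈))))
    (All.tabulate (λ b∈ → proj₁ (∈-range⁻ c (n ∸ k) b∈)))
  low : u ↭ range lo k
  low = proj₁ parts
  high : v ↭ range c (n ∸ k)
  high = proj₂ parts

sub∈ : ∀ {x : ℕ} {xs w} → (x ∷ xs) ⊆ w → x ∈ w
sub∈ s = Sublist.lookup s (here refl)

pair⊆++ : ∀ {b c : ℕ} (u : List ℕ) {v} → (b ∷ c ∷ []) ⊆ (u ++ v) →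
  (b ∷ c ∷ []) ⊆ u ⊎ (b ∈ u × c ∈ v) ⊎ (b ∷ c ∷ []) ⊆ v
pair⊆++ [] s = inj₂ (inj₂ s)
pair⊆++ (x ∷ u) (.x ∷ʳ s) with pair⊆++ u s
... | inj₁ s′               = inj₁ (x ∷ʳ s′)
... | inj₂ (inj₁ (b∈ , c∈)) = inj₂ (inj₁ (there b∈ , c∈))
... | inj₂ (inj₂ s′)        = inj₂ (inj₂ s′)
pair⊆++ (x ∷ u) (refl ∷ s) with ∈-++⁻ u (sub∈ s)
... | inj₁ c∈u = inj₁ (refl ∷ from∈ c∈u)
... | inj₂ c∈v = inj₂ (inj₁ (here refl , c∈v))

triple⊆++ : ∀ {a b c : ℕ} (u : List ℕ) {v} → (a ∷ b ∷ c ∷ []) ⊆ (u ++ v) →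
  (a ∷ b ∷ c ∷ []) ⊆ u ⊎ (a ∈ u × c ∈ v) ⊎ (a ∷ b ∷ c ∷ []) ⊆ v
triple⊆++ [] s = inj₂ (inj₂ s)
triple⊆++ (x ∷ u) (.x ∷ʳ s) with triple⊆++ u s
... | inj₁ s′               = inj₁ (x ∷ʳ s′)
... | inj₂ (inj₁ (a∈ , c∈)) = inj₂ (inj₁ (there a∈ , c∈))
... | inj₂ (inj₂ s′)        = inj₂ (inj₂ s′)
triple⊆++ (x ∷ u) (refl ∷ s) with pair⊆++ u s
... | inj₁ s′               = inj₁ (refl ∷ s′)
... | inj₂ (inj₁ (_ , c∈v)) = inj₂ (inj₁ (here refl , c∈v))
... | inj₂ (inj₂ s′)        = inj₂ (inj₁ (here refl , sub∈ (Sublist.∷ˡ⁻ s′)))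

Avoid231 : List ℕ → Set
Avoid231 w = ∀ {a b c} → (a ∷ b ∷ c ∷ []) ⊆ w → c < a → a < b → ⊥

Avoid213 : List ℕ → Set
Avoid213 w = ∀ {a b c} → (a ∷ b ∷ c ∷ []) ⊆ w → b < a → a < c → ⊥

SameOrder : ℕ → ℕ → ℕ → ℕ → Set
SameOrder x y p q = (x < y × p < q) ⊎ (y < x × q < p)

sameOrder-flip : ∀ {x y p q} → SameOrder x y p q → SameOrder y x q p
sameOrder-flip (inj₁ lt) = inj₂ lt
sameOrder-flip (inj₂ gt) = inj₁ gt

sameOrder⇒⇔ : ∀ {x y p q} → SameOrder x y p q → (x < y → p < q) × (p < q → x < y)
sameOrder⇒⇔ (inj₁ (x<y , p<q)) = (λ _ → p<q) , (λ _ → x<y)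
sameOrder⇒⇔ (inj₂ (y<x , q<p)) = (λ x<y → ⊥-elim (<-asym x<y y<x)) , (λ p<q → ⊥-elim (<-asym p<q q<p))

self⇔ : ∀ {x p} → (x < x → p < p) × (p < p → x < x)
self⇔ = (λ x<x → ⊥-elim (<-irr x<x)) , (λ p<p → ⊥-elim (<-irr p<p))

orderIso₃ : ∀ {a b c p q r} → SameOrder a b p q → SameOrder a c p r → SameOrder b c q r →
  OrderIso (a ∷ b ∷ c ∷ []) (p ∷ q ∷ r ∷ [])
orderIso₃ ab ac bc = refl , λ
  { zero zero → self⇔ ; (suc zero) (suc zero) → self⇔ ; (suc (suc zero)) (suc (suc zero)) → self⇔
  ; zero (suc zero) → sameOrder⇒⇔ ab ; (suc zero) zero → sameOrder⇒⇔ (sameOrder-flip ab)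
  ; zero (suc (suc zero)) → sameOrder⇒⇔ ac ; (suc (suc zero)) zero → sameOrder⇒⇔ (sameOrder-flip ac)
  ; (suc zero) (suc (suc zero)) → sameOrder⇒⇔ bc ; (suc (suc zero)) (suc zero) → sameOrder⇒⇔ (sameOrder-flip bc) }

1<2 : 1 < 2
1<2 = s≤s (s≤s z≤n)

0<n : ∀ {n} → 0 < suc n
0<n = s≤s z≤n

-- The concrete conditions agree with Avoids for 231 and 213, written 1 2 0 and 1 0 2.
avoids⇒Avoid231 : ∀ {w} → Avoids (1 ∷ 2 ∷ 0 ∷ []) w → Avoid231 w
avoids⇒Avoid231 avoid s c<a a<b =
  avoid (_ , s , orderIso₃ (inj₁ (a<b , 1<2)) (inj₂ (c<a , 0<n)) (inj₂ (<-trans c<a a<b , 0<n)))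

avoids⇒Avoid213 : ∀ {w} → Avoids (1 ∷ 0 ∷ 2 ∷ []) w → Avoid213 w
avoids⇒Avoid213 avoid s b<a a<c =
  avoid (_ , s , orderIso₃ (inj₂ (b<a , 0<n)) (inj₁ (a<c , 1<2)) (inj₁ (<-trans b<a a<c , 0<n)))

Avoid231⇒avoids : ∀ {w} → Avoid231 w → Avoids (1 ∷ 2 ∷ 0 ∷ []) w
Avoid231⇒avoids avoid (a ∷ b ∷ c ∷ [] , s , refl , iso) =
  avoid s (proj₂ (iso (suc (suc zero)) zero) 0<n) (proj₂ (iso zero (suc zero)) 1<2)

Avoid213⇒avoids : ∀ {w} → Avoid213 w → Avoids (1 ∷ 0 ∷ 2 ∷ []) w
Avoid213⇒avoids avoid (a ∷ b ∷ c ∷ [] , s , refl , iso) =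
  avoid s (proj₂ (iso (suc zero) zero) 0<n) (proj₂ (iso zero (suc (suc zero))) 1<2)

-- Reach a Q xs: after skipping a (possibly empty) block of letters larger than a,
-- the next letter x of xs, followed by the rest ys, satisfies Q x ys.
data Reach (a : ℕ) (Q : ℕ → List ℕ → Set) : List ℕ → Set where
  now  : ∀ {x xs} → Q x xs → Reach a Q (x ∷ xs)
  skip : ∀ {x xs} → a < x → Reach a Q xs → Reach a Q (x ∷ xs)

DescentBelow : ℕ → ℕ → List ℕ → Set
DescentBelow a b ys = b < a × Reach a (λ c _ → c < b) ys

-- A double descent a > b > c of some restriction of w to its small letters: every letter
-- of w strictly between a and c is larger than a.  This is how Simsun is used below.
data HiddenDD : List ℕ → Set where
  dd-at    : ∀ {a xs} → Reach a (DescentBelow a) xs → HiddenDD (a ∷ xs)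
  dd-later : ∀ {x xs} → HiddenDD xs → HiddenDD (x ∷ xs)

LastBelow : ℕ → ℕ → List ℕ → Set
LastBelow a b ys = b < a × All (a <_) ys

-- The restriction of w to letters ≤ a ends with a descent a > b.  Such a word followed by
-- a smaller letter has a hidden double descent, so the blocks placed before lo avoid it.
data HiddenEndDescent : List ℕ → Set where
  end-at    : ∀ {a xs} → Reach a (LastBelow a) xs → HiddenEndDescent (a ∷ xs)
  end-later : ∀ {x xs} → HiddenEndDescent xs → HiddenEndDescent (x ∷ xs)

Reach-map : ∀ {a Q Q′ xs} → (∀ {b ys} → Q b ys → Q′ b ys) → Reach a Q xs → Reach a Q′ xs
Reach-map f (now q)      = now (f q)
Reach-map f (skip a<x r) = skip a<x (Reach-map f r)

reached : ∀ {a Q xs} → Reach a Q xs → Σ ℕ λ b → Σ (List ℕ) λ ys → Q b ys × b ∈ xs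
reached (now q) = _ , _ , q , here refl
reached (skip _ r) with reached r
... | b , ys , q , b∈ = b , ys , q , there b∈

Reach-restrict : ∀ {a Q xs} → (∀ {b ys} → Q b ys → b < a) → Reach a Q xs →
  Σ ℕ λ b → Σ (List ℕ) λ ys → Q b ys × restrict (suc a) xs ≡ b ∷ restrict (suc a) ys
Reach-restrict {a} Q⇒<a (now q) = _ , _ , q , filter-accept (_<? suc a) (m<n⇒m<1+n (Q⇒<a q))
Reach-restrict {a} Q⇒<a (skip a<x r) with Reach-restrict Q⇒<a r
... | b , ys , q , eq = b , ys , q , trans (filter-reject (_<? suc a) (λ x≤a → <-irr (<-≤-trans a<x (≤-pred x≤a)))) eq

restrict-Reach : ∀ {x k} xs {b r} → x < k → restrict k xs ≡ b ∷ r →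
  Reach x (λ b′ ys → b′ ≡ b × restrict k ys ≡ r) xs
restrict-Reach {x} {k} (y ∷ ys) x<k eq with y <? k
... | yes y<k = now (∷-injective (trans (sym (filter-accept (_<? k) y<k)) eq))
... | no  y≮k = skip (<-≤-trans x<k (≮⇒≥ y≮k)) (restrict-Reach ys x<k (trans (sym (filter-reject (_<? k) y≮k)) eq))

hiddenDD⇒restrictedDD : ∀ {w} → HiddenDD w → Σ ℕ λ k → HasDoubleDescent (restrict k w)
hiddenDD⇒restrictedDD {x ∷ xs} (dd-later h) with hiddenDD⇒restrictedDD h
... | k , d with x <? k
... | yes x<k = k , subst HasDoubleDescent (sym (filter-accept (_<? k) x<k)) (there d)
... | no  x≮k = k , subst HasDoubleDescent (sym (filter-reject (_<? k) x≮k)) d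
hiddenDD⇒restrictedDD {a ∷ xs} (dd-at r) with Reach-restrict proj₁ r
... | b , ys , (b<a , r′) , eq with Reach-restrict {a} (λ c<b → <-trans c<b b<a) r′
... | c , zs , c<b , eq′ = suc a , subst HasDoubleDescent (sym restriction) (here b<a c<b)
  where
  restriction : restrict (suc a) (a ∷ xs) ≡ a ∷ b ∷ c ∷ restrict (suc a) zs
  restriction = trans (filter-accept (_<? suc a) (n<1+n a)) (cong (a ∷_) (trans eq (cong (b ∷_) eq′)))

restrictedDD⇒hiddenDD : ∀ k w → HasDoubleDescent (restrict k w) → HiddenDD w
restrictedDD⇒hiddenDD k (x ∷ xs) d with x <? k
... | no x≮k = dd-later (restrictedDD⇒hiddenDD k xs (subst HasDoubleDescent (filter-reject (_<? k) x≮k) d))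
... | yes x<k with restrict k xs in eq | subst HasDoubleDescent (filter-accept (_<? k) {xs = xs} x<k) d
...   | r | there d′ = dd-later (restrictedDD⇒hiddenDD k xs (subst HasDoubleDescent (sym eq) d′))
...   | b ∷ c ∷ r | here b<x c<b = dd-at (Reach-map descent (restrict-Reach xs x<k eq))
  where
  descent : ∀ {b′ ys} → b′ ≡ b × restrict k ys ≡ c ∷ r → DescentBelow x b′ ys
  descent (refl , eq′) = b<x , Reach-map (λ { (refl , _) → c<b }) (restrict-Reach _ x<k eq′)

simsun⇒noHiddenDD : ∀ {w} → Simsun w → ¬ HiddenDD w
simsun⇒noHiddenDD simsun h with hiddenDD⇒restrictedDD h
... | k , d = simsun k d

noHiddenDD⇒simsun : ∀ {w} → ¬ HiddenDD w → Simsun w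
noHiddenDD⇒simsun {w} noDD k d = noDD (restrictedDD⇒hiddenDD k w d)

Avoid231-⊆ : ∀ {xs ys} → xs ⊆ ys → Avoid231 ys → Avoid231 xs
Avoid231-⊆ xs⊆ys avoid s = avoid (⊆-trans s xs⊆ys)

Avoid213-⊆ : ∀ {xs ys} → xs ⊆ ys → Avoid213 ys → Avoid213 xs
Avoid213-⊆ xs⊆ys avoid s = avoid (⊆-trans s xs⊆ys)

Avoid231-++ : ∀ (u : List ℕ) {v m} → Avoid231 u → Avoid231 v → All (_< m) u → All (m ≤_) v → Avoid231 (u ++ v)
Avoid231-++ u avoidU avoidV u<m m≤v s c<a a<b with triple⊆++ u s
... | inj₁ s′               = avoidU s′ c<a a<b
... | inj₂ (inj₁ (a∈ , c∈)) = <-irr (<-trans (<-≤-trans (All.lookup u<m a∈) (All.lookup m≤v c∈)) c<a)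
... | inj₂ (inj₂ s′)        = avoidV s′ c<a a<b

Avoid213-++ : ∀ (u : List ℕ) {v m} → Avoid213 u → Avoid213 v → All (m ≤_) u → All (_< m) v → Avoid213 (u ++ v)
Avoid213-++ u avoidU avoidV m≤u v<m s b<a a<c with triple⊆++ u s
... | inj₁ s′               = avoidU s′ b<a a<c
... | inj₂ (inj₁ (a∈ , c∈)) = <-irr (<-trans (<-≤-trans (All.lookup v<m c∈) (All.lookup m≤u a∈)) a<c)
... | inj₂ (inj₂ s′)        = avoidV s′ b<a a<c

Avoid231-∷ : ∀ {x w} → All (x <_) w → Avoid231 w → Avoid231 (x ∷ w)
Avoid231-∷ x<w avoid (_ ∷ʳ s)    c<a a<b = avoid s c<a a<b
Avoid231-∷ x<w avoid (refl ∷ s) c<a a<b = <-irr (<-trans c<a (All.lookup x<w (sub∈ (Sublist.∷ˡ⁻ s))))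

Avoid213-∷ : ∀ {x w} → All (x <_) w → Avoid213 w → Avoid213 (x ∷ w)
Avoid213-∷ x<w avoid (_ ∷ʳ s)    b<a a<c = avoid s b<a a<c
Avoid213-∷ x<w avoid (refl ∷ s) b<a a<c = <-irr (<-trans b<a (All.lookup x<w (sub∈ s)))

Avoid231-peak : ∀ {lo x} L {H} → lo < x → All (_< x) L → All (x <_) H → Avoid231 (lo ∷ L ++ H) → Avoid231 (x ∷ lo ∷ (L ++ H))
Avoid231-peak L lo<x L<x x<H avoid (_ ∷ʳ s)           c<a a<b = avoid s c<a a<b
Avoid231-peak L lo<x L<x x<H avoid (refl ∷ (refl ∷ s)) c<a a<b = <-irr (<-trans lo<x a<b)
Avoid231-peak L lo<x L<x x<H avoid (refl ∷ (_ ∷ʳ s)) c<a a<b with pair⊆++ L s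
... | inj₁ s′          = <-irr (<-trans a<b (All.lookup L<x (sub∈ s′)))
... | inj₂ (inj₁ (b∈ , _)) = <-irr (<-trans a<b (All.lookup L<x b∈))
... | inj₂ (inj₂ s′)   = <-irr (<-trans c<a (All.lookup x<H (sub∈ (Sublist.∷ˡ⁻ s′))))

Reach-++ : ∀ {a Q} (u : List ℕ) {v} → Reach a Q (u ++ v) →
  Reach a (λ b ys → Q b (ys ++ v)) u ⊎ (All (a <_) u × Reach a Q v)
Reach-++ [] r = inj₂ ([] , r)
Reach-++ (x ∷ u) (now q) = inj₁ (now q)
Reach-++ (x ∷ u) (skip a<x r) with Reach-++ u r
... | inj₁ r′          = inj₁ (skip a<x r′)
... | inj₂ (a<u , r′)  = inj₂ (a<x ∷ a<u , r′)

Reach-⊎ : ∀ {a} {Q₁ Q₂ : ℕ → List ℕ → Set} {xs} → Reach a (λ b ys → Q₁ b ys ⊎ Q₂ b ys) xs → Reach a Q₁ xs ⊎ Reach a Q₂ xs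
Reach-⊎ (now (inj₁ q)) = inj₁ (now q)
Reach-⊎ (now (inj₂ q)) = inj₂ (now q)
Reach-⊎ (skip a<x r) with Reach-⊎ r
... | inj₁ r′ = inj₁ (skip a<x r′)
... | inj₂ r′ = inj₂ (skip a<x r′)

noDD-∷ : ∀ {x w} → All (x <_) w → ¬ HiddenDD w → ¬ HiddenDD (x ∷ w)
noDD-∷ x<w noDD (dd-later h) = noDD h
noDD-∷ x<w noDD (dd-at r) with reached r
... | b , _ , (b<x , _) , b∈ = <-irr (<-trans b<x (All.lookup x<w b∈))

noEnd-∷ : ∀ {x w} → All (x <_) w → ¬ HiddenEndDescent w → ¬ HiddenEndDescent (x ∷ w)
noEnd-∷ x<w noEnd (end-later e) = noEnd e
noEnd-∷ x<w noEnd (end-at r) with reached r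
... | b , _ , (b<x , _) , b∈ = <-irr (<-trans b<x (All.lookup x<w b∈))

noEnd-[_] : ∀ x → ¬ HiddenEndDescent (x ∷ [])
noEnd-[ x ] (end-at ())
noEnd-[ x ] (end-later ())

noDD-++ : ∀ (u : List ℕ) {v m} → ¬ HiddenDD u → ¬ HiddenDD v → All (_< m) u → All (m ≤_) v → ¬ HiddenDD (u ++ v)
noDD-++ [] noU noV u<m m≤v h = noV h
noDD-++ (x ∷ u) noU noV (_ ∷ u<m) m≤v (dd-later h) = noDD-++ u (λ h′ → noU (dd-later h′)) noV u<m m≤v h
noDD-++ (x ∷ u) {v} noU noV (x<m ∷ _) m≤v (dd-at r) with Reach-++ u r
... | inj₂ (_ , r′) with reached r′
...   | b , _ , (b<x , _) , b∈ = <-irr (<-trans b<x (<-≤-trans x<m (All.lookup m≤v b∈)))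
noDD-++ (x ∷ u) {v} noU noV (x<m ∷ _) m≤v (dd-at r) | inj₁ r′ = noU (dd-at (Reach-map insideU r′))
  where
  insideU : ∀ {b ys} → DescentBelow x b (ys ++ v) → DescentBelow x b ys
  insideU {b} {ys} (b<x , r″) with Reach-++ ys r″
  ... | inj₁ r‴ = b<x , r‴
  ... | inj₂ (_ , r‴) with reached r‴
  ...   | c , _ , c<b , c∈ = ⊥-elim (<-irr (<-trans c<b (<-trans b<x (<-≤-trans x<m (All.lookup m≤v c∈)))))

noDD-peak : ∀ {lo x r} → lo < x → All (lo <_) r → ¬ HiddenDD (lo ∷ r) → ¬ HiddenDD (x ∷ lo ∷ r)
noDD-peak lo<x lo<r noDD (dd-later h) = noDD h
noDD-peak lo<x lo<r noDD (dd-at (skip x<lo _)) = <-irr (<-trans lo<x x<lo)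
noDD-peak lo<x lo<r noDD (dd-at (now (_ , r′))) with reached r′
... | c , _ , c<lo , c∈ = <-irr (<-trans c<lo (All.lookup lo<r c∈))

noDD-++-below : ∀ (u : List ℕ) {lo v m} → ¬ HiddenDD u → ¬ HiddenEndDescent u → ¬ HiddenDD (lo ∷ v) →
  All (m ≤_) u → lo < m → All (lo <_) v → ¬ HiddenDD (u ++ lo ∷ v)
noDD-++-below [] noU noEnd noV m≤u lo<m lo<v h = noV h
noDD-++-below (x ∷ u) noU noEnd noV (_ ∷ m≤u) lo<m lo<v (dd-later h) =
  noDD-++-below u (λ h′ → noU (dd-later h′)) (λ e → noEnd (end-later e)) noV m≤u lo<m lo<v h
noDD-++-below (x ∷ u) {lo} {v} noU noEnd noV (m≤x ∷ _) lo<m lo<v (dd-at r) with Reach-++ u r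
... | inj₂ (_ , skip x<lo _) = <-irr (<-trans x<lo (<-≤-trans lo<m m≤x))
... | inj₂ (_ , now (_ , r′)) with reached r′
...   | c , _ , c<lo , c∈ = <-irr (<-trans c<lo (All.lookup lo<v c∈))
noDD-++-below (x ∷ u) {lo} {v} noU noEnd noV (m≤x ∷ _) lo<m lo<v (dd-at r) | inj₁ r′ with Reach-⊎ (Reach-map split r′)
  where
  split : ∀ {b ys} → DescentBelow x b (ys ++ lo ∷ v) → DescentBelow x b ys ⊎ LastBelow x b ys
  split {b} {ys} (b<x , r″) with Reach-++ ys r″
  ... | inj₁ r‴         = inj₁ (b<x , r‴)
  ... | inj₂ (x<ys , _) = inj₂ (b<x , x<ys)
... | inj₁ r″ = noU (dd-at r″)
... | inj₂ r″ = noEnd (end-at r″)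

-- The same for hidden end descents, provided lo ∷ v has more than one letter.
noEnd-++-below : ∀ (u : List ℕ) {lo y v m} → y ∈ v → All (m ≤_) u → lo < m → All (_< m) v → All (lo <_) v →
  ¬ HiddenEndDescent v → ¬ HiddenEndDescent (u ++ lo ∷ v)
noEnd-++-below [] y∈v m≤u lo<m v<m lo<v noEnd (end-later e) = noEnd e
noEnd-++-below [] y∈v m≤u lo<m v<m lo<v noEnd (end-at r) with reached r
... | b , _ , (b<lo , _) , b∈ = <-irr (<-trans b<lo (All.lookup lo<v b∈))
noEnd-++-below (x ∷ u) y∈v (_ ∷ m≤u) lo<m v<m lo<v noEnd (end-later e) = noEnd-++-below u y∈v m≤u lo<m v<m lo<v noEnd e
noEnd-++-below (x ∷ u) y∈v (m≤x ∷ _) lo<m v<m lo<v noEnd (end-at r) with Reach-++ u r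
... | inj₂ (_ , skip x<lo _) = <-irr (<-trans x<lo (<-≤-trans lo<m m≤x))
... | inj₂ (_ , now (_ , x<v)) = <-irr (<-trans (All.lookup x<v y∈v) (<-≤-trans (All.lookup v<m y∈v) m≤x))
... | inj₁ r′ with reached r′
...   | b , ys , (_ , x<ys++lo∷v) , _ with All.++⁻ʳ ys x<ys++lo∷v
...     | x<lo ∷ _ = <-irr (<-trans x<lo (<-≤-trans lo<m m≤x))

-- Unary-binary trees; a unary node accounts for one letter, a binary node for two.
data Tree : Set where
  leaf   : Tree
  unary  : Tree → Tree
  binary : Tree → Tree → Tree

size : Tree → ℕ
size leaf         = 0
size (unary t)    = suc (size t)
size (binary s t) = suc (suc (size s + size t))

word231 : ℕ → Tree → List ℕ
word231 lo leaf         = []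
word231 lo (unary t)    = lo ∷ word231 (suc lo) t
word231 lo (binary s t) = suc (lo + size s) ∷ lo ∷ (word231 (suc lo) s ++ word231 (suc (suc (lo + size s))) t)

-- A nonempty 213-avoiding simsun permutation of lo, …, lo + size t, without hidden end
-- descent.  A binary node writes the top letters (from s), then lo, then the letters
-- between them (from t).
block213 : ℕ → Tree → List ℕ
block213 lo leaf         = lo ∷ []
block213 lo (unary t)    = lo ∷ block213 (suc lo) t
block213 lo (binary s t) = block213 (suc (lo + suc (size t))) s ++ lo ∷ block213 (suc lo) t

word213 : ℕ → Tree → List ℕ
word213 lo leaf         = []
word213 lo (unary t)    = lo ∷ word213 (suc lo) t
word213 lo (binary s t) = block213 (suc (lo + size t)) s ++ lo ∷ word213 (suc lo) t

word231-perm : ∀ lo t → RangePerm lo (size t) (word231 lo t)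
word231-perm lo leaf         = ↭-refl
word231-perm lo (unary t)    = prep lo (word231-perm (suc lo) t)
word231-perm lo (binary s t) = begin
  x ∷ lo ∷ (S ++ T)                                        ↭⟨ swap x lo ↭-refl ⟩
  lo ∷ x ∷ (S ++ T)                                        ↭⟨ prep lo (shift x S T) ⟨
  lo ∷ (S ++ x ∷ T)                                        ↭⟨ prep lo (++⁺ (word231-perm (suc lo) s) (prep x (word231-perm (suc x) t))) ⟩
  lo ∷ (range (suc lo) (size s) ++ range x (suc (size t)))  ≡⟨ cong (lo ∷_) (sym (range-++ (suc lo) (size s) (suc (size t)))) ⟩
  lo ∷ range (suc lo) (size s + suc (size t))              ≡⟨ cong (λ k → lo ∷ range (suc lo) k) (+-suc (size s) (size t)) ⟩
  range lo (size (binary s t))                             ∎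
  where
  open PermutationReasoning
  x : ℕ
  x = suc (lo + size s)
  S T : List ℕ
  S = word231 (suc lo) s
  T = word231 (suc x) t

topThenBottom : ∀ lo {B T} j k → RangePerm (suc lo) j B → RangePerm (suc (lo + j)) (suc k) T →
  RangePerm lo (suc (suc (k + j))) (T ++ lo ∷ B)
topThenBottom lo {B} {T} j k B↭ T↭ = begin
  T ++ lo ∷ B                                           ↭⟨ ++-comm T (lo ∷ B) ⟩
  lo ∷ (B ++ T)                                         ↭⟨ prep lo (++⁺ B↭ T↭) ⟩
  lo ∷ (range (suc lo) j ++ range (suc lo + j) (suc k)) ≡⟨ cong (lo ∷_) (sym (range-++ (suc lo) j (suc k))) ⟩
  lo ∷ range (suc lo) (j + suc k)                       ≡⟨ cong (λ m → lo ∷ range (suc lo) m) (trans (+-suc j k) (cong suc (+-comm j k))) ⟩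
  range lo (suc (suc (k + j)))                          ∎
  where open PermutationReasoning

block213-perm : ∀ lo t → RangePerm lo (suc (size t)) (block213 lo t)
block213-perm lo leaf         = ↭-refl
block213-perm lo (unary t)    = prep lo (block213-perm (suc lo) t)
block213-perm lo (binary s t) =
  subst (λ m → RangePerm lo (suc (suc m)) (block213 lo (binary s t))) (+-suc (size s) (size t))
    (topThenBottom lo (suc (size t)) (size s) (block213-perm (suc lo) t) (block213-perm (suc (lo + suc (size t))) s))

word213-perm : ∀ lo t → RangePerm lo (size t) (word213 lo t)
word213-perm lo leaf         = ↭-refl
word213-perm lo (unary t)    = prep lo (word213-perm (suc lo) t)
word213-perm lo (binary s t) = topThenBottom lo (size t) (size s) (word213-perm (suc lo) t) (block213-perm (suc (lo + size t)) s)

word231-sound : ∀ lo t → ¬ HiddenDD (word231 lo t) × Avoid231 (word231 lo t)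
word231-sound lo leaf = (λ ()) , (λ ())
word231-sound lo (unary t) with word231-sound (suc lo) t
... | noDD , avoid = noDD-∷ lo<w noDD , Avoid231-∷ lo<w avoid
  where
  lo<w : All (lo <_) (word231 (suc lo) t)
  lo<w = lowerBound (word231-perm (suc lo) t)
word231-sound lo (binary s t) with word231-sound (suc lo) s | word231-sound (suc (suc (lo + size s))) t
... | noDDS , avoidS | noDDT , avoidT =
  noDD-peak lo<x lo<ST (noDD-∷ lo<ST (noDD-++ S noDDS noDDT S<x (All.map <⇒≤ x<T))) ,
  Avoid231-peak S lo<x S<x x<T (Avoid231-∷ lo<ST (Avoid231-++ S avoidS avoidT S<x (All.map <⇒≤ x<T)))
  where
  x : ℕ
  x = suc (lo + size s)
  S T : List ℕ
  S = word231 (suc lo) s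
  T = word231 (suc x) t
  lo<x : lo < x
  lo<x = s≤s (m≤m+n lo (size s))
  S<x : All (_< x) S
  S<x = upperBound (word231-perm (suc lo) s)
  x<T : All (x <_) T
  x<T = lowerBound (word231-perm (suc x) t)
  lo<ST : All (lo <_) (S ++ T)
  lo<ST = All.++⁺ (lowerBound (word231-perm (suc lo) s)) (All.map (<-trans lo<x) x<T)

topThenBottom-sound : ∀ lo j {T B} → RangePerm (suc lo) j B → All (suc (lo + j) ≤_) T →
  ¬ HiddenDD T × Avoid213 T × ¬ HiddenEndDescent T → ¬ HiddenDD B → Avoid213 B →
  ¬ HiddenDD (T ++ lo ∷ B) × Avoid213 (T ++ lo ∷ B)
topThenBottom-sound lo j {T} {B} B↭ m≤T (noDDT , avoidT , noEndT) noDDB avoidB =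
  noDD-++-below T noDDT noEndT (noDD-∷ (lowerBound B↭) noDDB) m≤T lo<m (lowerBound B↭) ,
  Avoid213-++ T avoidT (Avoid213-∷ (lowerBound B↭) avoidB) m≤T (lo<m ∷ upperBound B↭)
  where
  lo<m : lo < suc (lo + j)
  lo<m = s≤s (m≤m+n lo j)

-- Blocks moreover have no hidden end descent, as they may be followed by smaller letters.
block213-sound : ∀ lo t → ¬ HiddenDD (block213 lo t) × Avoid213 (block213 lo t) × ¬ HiddenEndDescent (block213 lo t)
block213-sound lo leaf = (λ { (dd-at ()) ; (dd-later ()) }) , (λ { (_ ∷ʳ ()) ; (_ ∷ ()) }) , noEnd-[ lo ]
block213-sound lo (unary t) with block213-sound (suc lo) t
... | noDD , avoid , noEnd = noDD-∷ lo<w noDD , Avoid213-∷ lo<w avoid , noEnd-∷ lo<w noEnd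
  where
  lo<w : All (lo <_) (block213 (suc lo) t)
  lo<w = lowerBound (block213-perm (suc lo) t)
block213-sound lo (binary s t) with block213-sound (suc lo) t
... | noDDB , avoidB , noEndB = proj₁ sound , proj₂ sound ,
  noEnd-++-below T (start∈ B↭) m≤T (s≤s (m≤m+n lo _)) (upperBound B↭) (lowerBound B↭) noEndB
  where
  m : ℕ
  m = suc (lo + suc (size t))
  T B : List ℕ
  T = block213 m s
  B = block213 (suc lo) t
  B↭ : RangePerm (suc lo) (suc (size t)) B
  B↭ = block213-perm (suc lo) t
  m≤T : All (m ≤_) T
  m≤T = lowerBound (block213-perm m s)
  sound : ¬ HiddenDD (T ++ lo ∷ B) × Avoid213 (T ++ lo ∷ B)
  sound = topThenBottom-sound lo (suc (size t)) B↭ m≤T (block213-sound m s) noDDB avoidB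

word213-sound : ∀ lo t → ¬ HiddenDD (word213 lo t) × Avoid213 (word213 lo t)
word213-sound lo leaf = (λ ()) , (λ ())
word213-sound lo (unary t) with word213-sound (suc lo) t
... | noDD , avoid = noDD-∷ lo<w noDD , Avoid213-∷ lo<w avoid
  where
  lo<w : All (lo <_) (word213 (suc lo) t)
  lo<w = lowerBound (word213-perm (suc lo) t)
word213-sound lo (binary s t) with word213-sound (suc lo) t
... | noDDB , avoidB = topThenBottom-sound lo (size t) (word213-perm (suc lo) t) (lowerBound (block213-perm m s)) (block213-sound m s) noDDB avoidB
  where
  m : ℕ
  m = suc (lo + size t)

locate : ℕ → List ℕ → Maybe (List ℕ × List ℕ)
locate v []       = nothing
locate v (x ∷ xs) with x ≟ v
... | yes _ = just ([] , xs)
... | no  _ = Maybe.map (Product.map₁ (x ∷_)) (locate v xs)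

locate-++ : ∀ v (α : List ℕ) β → All (_≢ v) α → locate v (α ++ v ∷ β) ≡ just (α , β)
locate-++ v [] β [] with v ≟ v
... | yes _   = refl
... | no  v≢v = ⊥-elim (v≢v refl)
locate-++ v (x ∷ α) β (x≢v ∷ α≢v) with x ≟ v
... | yes x≡v = ⊥-elim (x≢v x≡v)
... | no  _   = cong (Maybe.map (Product.map₁ (x ∷_))) (locate-++ v α β α≢v)

locate-just : ∀ v w {α β} → locate v w ≡ just (α , β) → (w ≡ α ++ v ∷ β) × All (_≢ v) α
locate-just v (x ∷ xs) eq with x ≟ v
locate-just v (x ∷ xs) refl | yes refl = refl , []
... | no x≢v with locate v xs in eq′
locate-just v (x ∷ xs) refl | no x≢v | just (α , β) with locate-just v xs eq′
... | xs≡ , α≢v = cong (x ∷_) xs≡ , x≢v ∷ α≢v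

locate-nothing : ∀ v w → locate v w ≡ nothing → v ∉ w
locate-nothing v (x ∷ xs) eq v∈ with x ≟ v
locate-nothing v (x ∷ xs) () v∈ | yes _
... | no x≢v with locate v xs in eq′
locate-nothing v (x ∷ xs) eq (here refl) | no x≢v | nothing = x≢v refl
locate-nothing v (x ∷ xs) eq (there v∈) | no x≢v | nothing = locate-nothing v xs eq′ v∈

-- Reading a tree off a word, by recursion on a fuel bound (at least the length of the word).
-- Each step locates the least letter lo and undoes one node of the corresponding decoder;
-- for word231, the x - lo - 1 letters after x ∷ lo are those between lo and x.
code231 : ℕ → ℕ → List ℕ → Tree
code231-at : ℕ → ℕ → Maybe (List ℕ × List ℕ) → Tree
code231 zero    lo w = leaf
code231 (suc f) lo w = code231-at f lo (locate lo w)
code231-at f lo nothing            = leaf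
code231-at f lo (just ([] , β))    = unary (code231 f (suc lo) β)
code231-at f lo (just (x ∷ _ , β)) = binary (code231 f (suc lo) (take (x ∸ suc lo) β)) (code231 f (suc x) (drop (x ∸ suc lo) β))

codeBlock : ℕ → ℕ → List ℕ → Tree
codeBlock-at : ℕ → ℕ → Maybe (List ℕ × List ℕ) → Tree
codeBlock zero    lo w = leaf
codeBlock (suc f) lo w = codeBlock-at f lo (locate lo w)
codeBlock-at f lo nothing                = leaf
codeBlock-at f lo (just ([] , []))       = leaf
codeBlock-at f lo (just ([] , y ∷ δ))    = unary (codeBlock f (suc lo) (y ∷ δ))
codeBlock-at f lo (just (x ∷ α , δ))     = binary (codeBlock f (suc (lo + length δ)) (x ∷ α)) (codeBlock f (suc lo) δ)

code213 : ℕ → ℕ → List ℕ → Tree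
code213-at : ℕ → ℕ → Maybe (List ℕ × List ℕ) → Tree
code213 zero    lo w = leaf
code213 (suc f) lo w = code213-at f lo (locate lo w)
code213-at f lo nothing            = leaf
code213-at f lo (just ([] , β))    = unary (code213 f (suc lo) β)
code213-at f lo (just (x ∷ α , β)) = binary (codeBlock f (suc (lo + length β)) (x ∷ α)) (code213 f (suc lo) β)

codeBlock-at-unary : ∀ f lo δ → δ ≢ [] → codeBlock-at f lo (just ([] , δ)) ≡ unary (codeBlock f (suc lo) δ)
codeBlock-at-unary f lo []      δ≢[] = ⊥-elim (δ≢[] refl)
codeBlock-at-unary f lo (y ∷ δ) δ≢[] = refl

codeBlock-at-binary : ∀ f lo α δ → α ≢ [] →
  codeBlock-at f lo (just (α , δ)) ≡ binary (codeBlock f (suc (lo + length δ)) α) (codeBlock f (suc lo) δ)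
codeBlock-at-binary f lo []      δ α≢[] = ⊥-elim (α≢[] refl)
codeBlock-at-binary f lo (x ∷ α) δ α≢[] = refl

code213-at-binary : ∀ f lo α β → α ≢ [] →
  code213-at f lo (just (α , β)) ≡ binary (codeBlock f (suc (lo + length β)) α) (code213 f (suc lo) β)
code213-at-binary f lo []      β α≢[] = ⊥-elim (α≢[] refl)
code213-at-binary f lo (x ∷ α) β α≢[] = refl

take-length-++ : ∀ (u v : List ℕ) → take (length u) (u ++ v) ≡ u
take-length-++ []      v = refl
take-length-++ (x ∷ u) v = cong (x ∷_) (take-length-++ u v)

drop-length-++ : ∀ (u v : List ℕ) → drop (length u) (u ++ v) ≡ v
drop-length-++ []      v = refl
drop-length-++ (x ∷ u) v = drop-length-++ u v

block213-nonempty : ∀ lo t → block213 lo t ≢ []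
block213-nonempty lo t eq with trans (sym (rangePerm-length (block213-perm lo t))) (cong length eq)
... | ()

above⇒≢ : ∀ {lo m} {w : List ℕ} → lo < m → All (m ≤_) w → All (_≢ lo) w
above⇒≢ lo<m m≤w = All.map (λ m≤v v≡lo → <-irr (<-≤-trans lo<m (subst (_ ≤_) v≡lo m≤v))) m≤w

fuelˡ : ∀ s t {f} → suc (size s + size t) ≤ f → size s ≤ f
fuelˡ s t h = ≤-trans (m≤m+n (size s) (size t)) (≤-trans (n≤1+n _) h)

fuelʳ : ∀ s t {f} → suc (size s + size t) ≤ f → size t ≤ f
fuelʳ s t h = ≤-trans (m≤n+m (size t) (size s)) (≤-trans (n≤1+n _) h)

code231-word231 : ∀ f lo t → size t ≤ f → code231 f lo (word231 lo t) ≡ t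
code231-word231 zero    lo leaf h = refl
code231-word231 (suc f) lo leaf h = refl
code231-word231 (suc f) lo (unary t) (s≤s h) =
  trans (cong (code231-at f lo) (locate-++ lo [] _ [])) (cong unary (code231-word231 f (suc lo) t h))
code231-word231 (suc f) lo (binary s t) (s≤s h) = begin
  code231 (suc f) lo (x ∷ lo ∷ (S ++ T))                 ≡⟨ cong (code231-at f lo) (locate-++ lo (x ∷ []) (S ++ T) (above⇒≢ ≤-refl (s≤s (m≤m+n lo (size s)) ∷ []))) ⟩
  binary (code231 f (suc lo) (take k (S ++ T))) (code231 f (suc x) (drop k (S ++ T)))
                                                         ≡⟨ cong (λ j → binary (code231 f (suc lo) (take j (S ++ T))) (code231 f (suc x) (drop j (S ++ T)))) k≡ ⟩
  binary (code231 f (suc lo) (take (length S) (S ++ T))) (code231 f (suc x) (drop (length S) (S ++ T)))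
                                                         ≡⟨ cong₂ binary (cong (code231 f (suc lo)) (take-length-++ S T)) (cong (code231 f (suc x)) (drop-length-++ S T)) ⟩
  binary (code231 f (suc lo) S) (code231 f (suc x) T)   ≡⟨ cong₂ binary (code231-word231 f (suc lo) s (fuelˡ s t h)) (code231-word231 f (suc x) t (fuelʳ s t h)) ⟩
  binary s t                                             ∎
  where
  open ≡-Reasoning
  x k : ℕ
  x = suc (lo + size s)
  k = x ∸ suc lo
  S T : List ℕ
  S = word231 (suc lo) s
  T = word231 (suc x) t
  k≡ : k ≡ length S
  k≡ = trans (m+n∸m≡n lo (size s)) (sym (rangePerm-length (word231-perm (suc lo) s)))

codeBlock-block213 : ∀ f lo t → size t ≤ f → codeBlock f lo (block213 lo t) ≡ t
codeBlock-block213 zero    lo leaf h = refl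
codeBlock-block213 (suc f) lo leaf h = cong (codeBlock-at f lo) (locate-++ lo [] [] [])
codeBlock-block213 (suc f) lo (unary t) (s≤s h) = begin
  codeBlock-at f lo (locate lo (lo ∷ B))        ≡⟨ cong (codeBlock-at f lo) (locate-++ lo [] B []) ⟩
  codeBlock-at f lo (just ([] , B))             ≡⟨ codeBlock-at-unary f lo B (block213-nonempty (suc lo) t) ⟩
  unary (codeBlock f (suc lo) B)                ≡⟨ cong unary (codeBlock-block213 f (suc lo) t h) ⟩
  unary t                                       ∎
  where
  open ≡-Reasoning
  B : List ℕ
  B = block213 (suc lo) t
codeBlock-block213 (suc f) lo (binary s t) (s≤s h) = begin
  codeBlock-at f lo (locate lo (T ++ lo ∷ B))   ≡⟨ cong (codeBlock-at f lo) (locate-++ lo T B (above⇒≢ (s≤s (m≤m+n lo _)) (lowerBound (block213-perm m s)))) ⟩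
  codeBlock-at f lo (just (T , B))              ≡⟨ codeBlock-at-binary f lo T B (block213-nonempty m s) ⟩
  binary (codeBlock f (suc (lo + length B)) T) (codeBlock f (suc lo) B)
                                                ≡⟨ cong (λ k → binary (codeBlock f (suc (lo + k)) T) (codeBlock f (suc lo) B)) (rangePerm-length (block213-perm (suc lo) t)) ⟩
  binary (codeBlock f m T) (codeBlock f (suc lo) B)
                                                ≡⟨ cong₂ binary (codeBlock-block213 f m s (fuelˡ s t h)) (codeBlock-block213 f (suc lo) t (fuelʳ s t h)) ⟩
  binary s t                                    ∎
  where
  open ≡-Reasoning
  m : ℕ
  m = suc (lo + suc (size t))
  T B : List ℕ
  T = block213 m s
  B = block213 (suc lo) t

code213-word213 : ∀ f lo t → size t ≤ f → code213 f lo (word213 lo t) ≡ t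
code213-word213 zero    lo leaf h = refl
code213-word213 (suc f) lo leaf h = refl
code213-word213 (suc f) lo (unary t) (s≤s h) =
  trans (cong (code213-at f lo) (locate-++ lo [] _ [])) (cong unary (code213-word213 f (suc lo) t h))
code213-word213 (suc f) lo (binary s t) (s≤s h) = begin
  code213-at f lo (locate lo (T ++ lo ∷ B))     ≡⟨ cong (code213-at f lo) (locate-++ lo T B (above⇒≢ (s≤s (m≤m+n lo _)) (lowerBound (block213-perm m s)))) ⟩
  code213-at f lo (just (T , B))                ≡⟨ code213-at-binary f lo T B (block213-nonempty m s) ⟩
  binary (codeBlock f (suc (lo + length B)) T) (code213 f (suc lo) B)
                                                ≡⟨ cong (λ k → binary (codeBlock f (suc (lo + k)) T) (code213 f (suc lo) B)) (rangePerm-length (word213-perm (suc lo) t)) ⟩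
  binary (codeBlock f m T) (code213 f (suc lo) B)
                                                ≡⟨ cong₂ binary (codeBlock-block213 f m s (fuelˡ s t h)) (code213-word213 f (suc lo) t (fuelʳ s t h)) ⟩
  binary s t                                    ∎
  where
  open ≡-Reasoning
  m : ℕ
  m = suc (lo + size t)
  T B : List ℕ
  T = block213 m s
  B = word213 (suc lo) t

HiddenDD-++ˡ : ∀ (u : List ℕ) {v} → HiddenDD v → HiddenDD (u ++ v)
HiddenDD-++ˡ []      h = h
HiddenDD-++ˡ (x ∷ u) h = dd-later (HiddenDD-++ˡ u h)

HiddenEnd-++ˡ : ∀ (u : List ℕ) {v} → HiddenEndDescent v → HiddenEndDescent (u ++ v)
HiddenEnd-++ˡ []      e = e
HiddenEnd-++ˡ (x ∷ u) e = end-later (HiddenEnd-++ˡ u e)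

Reach-++ʳ : ∀ {a Q xs} v → (∀ {b ys} → Q b ys → Q b (ys ++ v)) → Reach a Q xs → Reach a Q (xs ++ v)
Reach-++ʳ v ext (now q)      = now (ext q)
Reach-++ʳ v ext (skip a<x r) = skip a<x (Reach-++ʳ v ext r)

HiddenDD-++ʳ : ∀ {u : List ℕ} v → HiddenDD u → HiddenDD (u ++ v)
HiddenDD-++ʳ v (dd-later h) = dd-later (HiddenDD-++ʳ v h)
HiddenDD-++ʳ v (dd-at r)    = dd-at (Reach-++ʳ v (λ { (b<a , r′) → b<a , Reach-++ʳ v (λ c<b → c<b) r′ }) r)

Reach-skipAll : ∀ {a Q} {ys : List ℕ} {v} → All (a <_) ys → Reach a Q v → Reach a Q (ys ++ v)
Reach-skipAll []           r = r
Reach-skipAll (a<y ∷ a<ys) r = skip a<y (Reach-skipAll a<ys r)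

HiddenEnd⇒DD : ∀ {lo} {u : List ℕ} v → All (lo <_) u → HiddenEndDescent u → HiddenDD (u ++ lo ∷ v)
HiddenEnd⇒DD v (_ ∷ lo<u) (end-later e) = dd-later (HiddenEnd⇒DD v lo<u e)
HiddenEnd⇒DD v (_ ∷ lo<u) (end-at r)    = dd-at (extend lo<u r)
  where
  extend : ∀ {lo a} {xs : List ℕ} → All (lo <_) xs → Reach a (LastBelow a) xs → Reach a (DescentBelow a) (xs ++ lo ∷ v)
  extend (lo<x ∷ _)  (now (b<a , a<ys)) = now (b<a , Reach-skipAll a<ys (now lo<x))
  extend (_ ∷ lo<xs) (skip a<x r)       = skip a<x (extend lo<xs r)

endsInDescent : ∀ {lo} x (α : List ℕ) → All (lo <_) (x ∷ α) → HiddenEndDescent ((x ∷ α) ++ lo ∷ [])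
endsInDescent x []      (lo<x ∷ _) = end-at (now (lo<x , []))
endsInDescent x (y ∷ α) (_ ∷ lo<α) = end-later (endsInDescent y α lo<α)

Unique-++-disjoint : ∀ (u : List ℕ) {v a b} → Unique (u ++ v) → a ∈ u → b ∈ v → a ≢ b
Unique-++-disjoint (x ∷ u) (x∉ ∷ _) (here refl) b∈v = All.lookup x∉ (∈-++⁺ʳ u b∈v)
Unique-++-disjoint (x ∷ u) (_ ∷ distinct) (there a∈u) b∈v = Unique-++-disjoint u distinct a∈u b∈v

-- Two or more letters above lo just before lo contain an ascent (giving a 231 with lo) or
-- descend all the way into lo (giving a hidden double descent).
ascentOrDD : ∀ {lo β} x y r → Unique ((x ∷ y ∷ r) ++ lo ∷ β) → All (lo <_) (x ∷ y ∷ r) →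
  (Σ ℕ λ p → Σ ℕ λ q → ((p ∷ q ∷ []) ⊆ (x ∷ y ∷ r)) × p < q) ⊎ HiddenDD ((x ∷ y ∷ r) ++ lo ∷ β)
ascentOrDD x y r distinct lo< with <-cmp x y
ascentOrDD x y r distinct lo< | tri< x<y _ _ = inj₁ (x , y , refl ∷ (refl ∷ minimum _) , x<y)
ascentOrDD x y r ((x∉ ∷ _) ∷ _) lo< | tri≈ _ x≡y _ = ⊥-elim (x∉ x≡y)
ascentOrDD x y [] distinct (_ ∷ lo<y ∷ _) | tri> _ _ y<x = inj₂ (dd-at (now (y<x , now lo<y)))
ascentOrDD x y (z ∷ r) (_ ∷ distinct) (_ ∷ lo<) | tri> _ _ y<x with ascentOrDD y z r distinct lo<
... | inj₁ (p , q , s , p<q) = inj₁ (p , q , x ∷ʳ s , p<q)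
... | inj₂ h                 = inj₂ (dd-later h)

lowThenHigh : ∀ x (β : List ℕ) → Avoid231 (x ∷ β) → x ∉ β →
  Σ (List ℕ) λ L → Σ (List ℕ) λ H → (β ≡ L ++ H) × All (_< x) L × All (x <_) H
lowThenHigh x []      avoid x∉ = [] , [] , refl , [] , []
lowThenHigh x (y ∷ β) avoid x∉ with <-cmp y x
... | tri≈ _ y≡x _ = ⊥-elim (x∉ (here (sym y≡x)))
... | tri< y<x _ _ with lowThenHigh x β (Avoid231-⊆ (refl ∷ (y ∷ʳ ⊆-refl)) avoid) (λ x∈ → x∉ (there x∈))
...   | L , H , β≡ , L<x , x<H = y ∷ L , H , cong (y ∷_) β≡ , y<x ∷ L<x , x<H
lowThenHigh x (y ∷ β) avoid x∉ | tri> _ _ x<y = [] , y ∷ β , refl , [] , x<y ∷ All.tabulate x<z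
  where
  x<z : ∀ {z} → z ∈ β → x < z
  x<z {z} z∈ with <-cmp z x
  ... | tri< z<x _ _ = ⊥-elim (avoid (refl ∷ (refl ∷ from∈ z∈)) z<x x<y)
  ... | tri≈ _ z≡x _ = ⊥-elim (x∉ (there (subst (_∈ β) z≡x z∈)))
  ... | tri> _ _ x<z = x<z

separatedBy : ∀ {x : ℕ} {u v} → All (_< x) u → All (x ≤_) v → ∀ {a b} → a ∈ u → b ∈ v → a < b
separatedBy u<x x≤v a∈ b∈ = <-≤-trans (All.lookup u<x a∈) (All.lookup x≤v b∈)

decompose231 : ∀ {lo n x} β → RangePerm lo n (x ∷ lo ∷ β) → x ≢ lo → Avoid231 (x ∷ lo ∷ β) →
  Σ (List ℕ) λ L → Σ (List ℕ) λ H → (β ≡ L ++ H) ×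
    RangePerm (suc lo) (length L) L × RangePerm (suc x) (length H) H × (x ≡ suc (lo + length L))
decompose231 {lo} {n} {x} β p x≢lo avoid
  with lowThenHigh x β (Avoid231-⊆ (refl ∷ (lo ∷ʳ ⊆-refl)) avoid) x∉β
  where
  x∉β : x ∉ β
  x∉β x∈ with rangePerm-unique p
  ... | x∉ ∷ _ = All.lookup x∉ (there x∈) refl
... | L , H , refl , L<x , x<H with rangePerm-split (lo ∷ L) (x ∷ H) reordered (separatedBy (lo<x ∷ L<x) (≤-refl ∷ All.map <⇒≤ x<H))
  where
  lo<x : lo < x
  lo<x = ≤∧≢⇒< (All.head (lowerBound p)) (λ lo≡x → x≢lo (sym lo≡x))
  reordered : RangePerm lo n ((lo ∷ L) ++ (x ∷ H))
  reordered = ↭-trans (prep lo (shift x L H)) (↭-trans (swap lo x ↭-refl) p)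
... | low , high with rangePerm-head high x<H
... | refl = L , H , refl , drop-∷ low , drop-∷ high , +-suc lo (length L)

decompose213 : ∀ {lo n} A β → RangePerm lo n (A ++ lo ∷ β) → All (_≢ lo) A → Avoid213 (A ++ lo ∷ β) →
  RangePerm (suc lo) (length β) β × RangePerm (suc (lo + length β)) (length A) A
decompose213 {lo} {n} A β p A≢lo avoid with rangePerm-split (lo ∷ β) A (↭-trans (++-comm (lo ∷ β) A) p) below
  where
  lo<A : All (lo <_) A
  lo<A = aboveStart A p A≢lo
  β<A : ∀ {a b} → a ∈ A → b ∈ β → b < a
  β<A {a} {b} a∈ b∈ with <-cmp a b
  ... | tri< a<b _ _ = ⊥-elim (avoid (Sublist.++⁺ (from∈ a∈) (refl ∷ from∈ b∈)) (All.lookup lo<A a∈) a<b)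
  ... | tri≈ _ a≡b _ = ⊥-elim (Unique-++-disjoint A (rangePerm-unique p) a∈ (there b∈) a≡b)
  ... | tri> _ _ b<a = b<a
  below : ∀ {b a} → b ∈ lo ∷ β → a ∈ A → b < a
  below (here refl) a∈ = All.lookup lo<A a∈
  below (there b∈)  a∈ = β<A a∈ b∈
... | low , high = drop-∷ low , subst (λ s → RangePerm s (length A) A) (+-suc lo (length β)) high

locate-start : ∀ {lo n w} → RangePerm lo n w → locate lo w ≡ nothing → w ≡ []
locate-start {w = []} p eq = refl
locate-start {lo} {zero} {w = x ∷ w} p eq with rangePerm-length {lo} {zero} p
... | ()
locate-start {lo} {suc n} {w = x ∷ w} p eq = ⊥-elim (locate-nothing lo (x ∷ w) eq (start∈ p))

dropStart : ∀ {lo n β} → RangePerm lo n (lo ∷ β) → RangePerm (suc lo) (length β) β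
dropStart p = drop-∷ (reindex refl p)

length-before : ∀ (u : List ℕ) {x} v → length u < length (u ++ x ∷ v)
length-before []      v = s≤s z≤n
length-before (a ∷ u) v = s≤s (length-before u v)

length-after : ∀ (u : List ℕ) {x} v → length v < length (u ++ x ∷ v)
length-after []      v = ≤-refl
length-after (a ∷ u) v = m<n⇒m<1+n (length-after u v)

fuel-++ˡ : ∀ (u : List ℕ) {x} v {f} → length (u ++ x ∷ v) ≤ suc f → length u ≤ f
fuel-++ˡ u {x} v h = ≤-pred (<-≤-trans (length-before u {x} v) h)

fuel-++ʳ : ∀ (u : List ℕ) {x} v {f} → length (u ++ x ∷ v) ≤ suc f → length v ≤ f
fuel-++ʳ u {x} v h = ≤-pred (<-≤-trans (length-after u {x} v) h)

-- By the position of lo: first (a unary node), second (a binary node, by decompose231), or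
-- later (impossible, by ascentOrDD).
word231-code231 : ∀ f lo {n} w → length w ≤ f → RangePerm lo n w → ¬ HiddenDD w → Avoid231 w →
  word231 lo (code231 f lo w) ≡ w
word231-code231 zero    lo []      h p noDD avoid = refl
word231-code231 (suc f) lo w       h p noDD avoid with locate lo w in eq
... | nothing with locate-start p eq
...   | refl = refl
word231-code231 (suc f) lo w h p noDD avoid | just ([] , β) with locate-just lo w eq
... | refl , _ = cong (lo ∷_) (word231-code231 f (suc lo) β (≤-pred h) (dropStart p) (λ d → noDD (dd-later d)) (Avoid231-⊆ (lo ∷ʳ ⊆-refl) avoid))
word231-code231 (suc f) lo w h p noDD avoid | just (x ∷ y ∷ α , β) with locate-just lo w eq
... | refl , α≢lo with ascentOrDD x y α (rangePerm-unique p) (aboveStart (x ∷ y ∷ α) p α≢lo)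
...   | inj₂ d = ⊥-elim (noDD d)
...   | inj₁ (a , b , s , a<b) =
  ⊥-elim (avoid (Sublist.++⁺ s (refl ∷ minimum β)) (All.lookup (aboveStart (x ∷ y ∷ α) p α≢lo) (sub∈ s)) a<b)
word231-code231 (suc f) lo w h p noDD avoid | just (x ∷ [] , β) with locate-just lo w eq
... | refl , (x≢lo ∷ []) with decompose231 β p x≢lo avoid
... | L , H , refl , pL , pH , x≡ = begin
  word231 lo (binary (code231 f (suc lo) (take k (L ++ H))) (code231 f (suc x) (drop k (L ++ H))))
      ≡⟨ cong (λ j → word231 lo (binary (code231 f (suc lo) (take j (L ++ H))) (code231 f (suc x) (drop j (L ++ H))))) k≡ ⟩
  word231 lo (binary tL (code231 f (suc x) (drop (length L) (L ++ H))))
      ≡⟨ cong (λ R → word231 lo (binary tL (code231 f (suc x) R))) (drop-length-++ L H) ⟩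
  suc (lo + size tL) ∷ lo ∷ (word231 (suc lo) tL ++ word231 (suc (suc (lo + size tL))) tH)
      ≡⟨ cong (λ y → y ∷ lo ∷ (word231 (suc lo) tL ++ word231 (suc y) tH)) x′≡x ⟩
  x ∷ lo ∷ (word231 (suc lo) tL ++ word231 (suc x) tH)
      ≡⟨ cong₂ (λ L′ H′ → x ∷ lo ∷ (L′ ++ H′)) IH-L IH-H ⟩
  x ∷ lo ∷ (L ++ H) ∎
  where
  open ≡-Reasoning
  k : ℕ
  k = x ∸ suc lo
  k≡ : k ≡ length L
  k≡ = trans (cong (_∸ suc lo) x≡) (m+n∸m≡n lo (length L))
  fuel-LH : length (L ++ H) ≤ f
  fuel-LH = fuel-++ʳ (x ∷ []) {lo} (L ++ H) h
  tL tH : Tree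
  tL = code231 f (suc lo) (take (length L) (L ++ H))
  tH = code231 f (suc x) H
  IH-L : word231 (suc lo) tL ≡ L
  IH-L = trans (cong (λ R → word231 (suc lo) (code231 f (suc lo) R)) (take-length-++ L H))
    (word231-code231 f (suc lo) L (≤-trans (length-++-≤ˡ L) fuel-LH) pL
      (λ d → noDD (dd-later (dd-later (HiddenDD-++ʳ H d)))) (Avoid231-⊆ (x ∷ʳ (lo ∷ʳ Sublist.++⁺ʳ H ⊆-refl)) avoid))
  IH-H : word231 (suc x) tH ≡ H
  IH-H = word231-code231 f (suc x) H (≤-trans (length-++-≤ʳ H {L}) fuel-LH) pH
    (λ d → noDD (dd-later (dd-later (HiddenDD-++ˡ L d)))) (Avoid231-⊆ (x ∷ʳ (lo ∷ʳ Sublist.++⁺ˡ L ⊆-refl)) avoid)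
  x′≡x : suc (lo + size tL) ≡ x
  x′≡x = trans (cong (λ k → suc (lo + k)) (trans (sym (rangePerm-length (word231-perm (suc lo) tL))) (cong length IH-L))) (sym x≡)

-- The same for nonempty 213-avoiding simsun range permutations without hidden end descent.
-- Here lo cannot come last after other letters, since it would end in a descent.
block213-codeBlock : ∀ f lo {n} w → length w ≤ f → RangePerm lo n w → w ≢ [] →
  ¬ HiddenDD w → Avoid213 w → ¬ HiddenEndDescent w → block213 lo (codeBlock f lo w) ≡ w
block213-codeBlock zero    lo []      h p w≢[] noDD avoid noEnd = ⊥-elim (w≢[] refl)
block213-codeBlock (suc f) lo w       h p w≢[] noDD avoid noEnd with locate lo w in eq
... | nothing = ⊥-elim (w≢[] (locate-start p eq))
... | just ([] , []) with locate-just lo w eq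
...   | refl , _ = refl
block213-codeBlock (suc f) lo w h p w≢[] noDD avoid noEnd | just ([] , y ∷ δ) with locate-just lo w eq
... | refl , _ = cong (lo ∷_) (block213-codeBlock f (suc lo) (y ∷ δ) (≤-pred h) (dropStart p) (λ ()) (λ d → noDD (dd-later d))
                  (Avoid213-⊆ (lo ∷ʳ ⊆-refl) avoid) (λ e → noEnd (end-later e)))
block213-codeBlock (suc f) lo w h p w≢[] noDD avoid noEnd | just (x ∷ α , []) with locate-just lo w eq
... | refl , A≢lo = ⊥-elim (noEnd (endsInDescent x α (aboveStart (x ∷ α) p A≢lo)))
block213-codeBlock (suc f) lo w h p w≢[] noDD avoid noEnd | just (x ∷ α , y ∷ δ) with locate-just lo w eq
... | refl , A≢lo = cong₂ (λ A′ D′ → A′ ++ lo ∷ D′) IH-A IH-D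
  where
  A D : List ℕ
  A = x ∷ α
  D = y ∷ δ
  parts : RangePerm (suc lo) (length D) D × RangePerm (suc (lo + length D)) (length A) A
  parts = decompose213 A D p A≢lo avoid
  pD : RangePerm (suc lo) (length D) D
  pD = proj₁ parts
  pA : RangePerm (suc (lo + length D)) (length A) A
  pA = proj₂ parts
  tA : Tree
  tA = codeBlock f (suc (lo + length D)) A
  tD : Tree
  tD = codeBlock f (suc lo) D
  IH-D : block213 (suc lo) tD ≡ D
  IH-D = block213-codeBlock f (suc lo) D (fuel-++ʳ A D h) pD (λ ()) (λ d → noDD (HiddenDD-++ˡ A (dd-later d)))
           (Avoid213-⊆ (Sublist.++⁺ˡ A (lo ∷ʳ ⊆-refl)) avoid) (λ e → noEnd (HiddenEnd-++ˡ A (end-later e)))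
  IH-A : block213 (suc (lo + suc (size tD))) tA ≡ A
  IH-A = trans (cong (λ k → block213 (suc (lo + k)) tA) (trans (sym (rangePerm-length (block213-perm (suc lo) tD))) (cong length IH-D)))
    (block213-codeBlock f (suc (lo + length D)) A (fuel-++ˡ A D h) pA (λ ()) (λ d → noDD (HiddenDD-++ʳ (lo ∷ D) d))
      (Avoid213-⊆ (Sublist.++⁺ʳ (lo ∷ D) ⊆-refl) avoid) (λ e → noDD (HiddenEnd⇒DD D (aboveStart A p A≢lo) e)))

word213-code213 : ∀ f lo {n} w → length w ≤ f → RangePerm lo n w → ¬ HiddenDD w → Avoid213 w →
  word213 lo (code213 f lo w) ≡ w
word213-code213 zero    lo []      h p noDD avoid = refl
word213-code213 (suc f) lo w       h p noDD avoid with locate lo w in eq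
... | nothing with locate-start p eq
...   | refl = refl
word213-code213 (suc f) lo w h p noDD avoid | just ([] , β) with locate-just lo w eq
... | refl , _ = cong (lo ∷_) (word213-code213 f (suc lo) β (≤-pred h) (dropStart p) (λ d → noDD (dd-later d)) (Avoid213-⊆ (lo ∷ʳ ⊆-refl) avoid))
word213-code213 (suc f) lo w h p noDD avoid | just (x ∷ α , β) with locate-just lo w eq
... | refl , A≢lo = cong₂ (λ A′ B′ → A′ ++ lo ∷ B′) IH-A IH-B
  where
  A : List ℕ
  A = x ∷ α
  parts : RangePerm (suc lo) (length β) β × RangePerm (suc (lo + length β)) (length A) A
  parts = decompose213 A β p A≢lo avoid
  pB : RangePerm (suc lo) (length β) β
  pB = proj₁ parts
  pA : RangePerm (suc (lo + length β)) (length A) A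
  pA = proj₂ parts
  tA : Tree
  tA = codeBlock f (suc (lo + length β)) A
  tB : Tree
  tB = code213 f (suc lo) β
  IH-B : word213 (suc lo) tB ≡ β
  IH-B = word213-code213 f (suc lo) β (fuel-++ʳ A β h) pB (λ d → noDD (HiddenDD-++ˡ A (dd-later d))) (Avoid213-⊆ (Sublist.++⁺ˡ A (lo ∷ʳ ⊆-refl)) avoid)
  IH-A : block213 (suc (lo + size tB)) tA ≡ A
  IH-A = trans (cong (λ k → block213 (suc (lo + k)) tA) (trans (sym (rangePerm-length (word213-perm (suc lo) tB))) (cong length IH-B)))
    (block213-codeBlock f (suc (lo + length β)) A (fuel-++ˡ A β h) pA (λ ()) (λ d → noDD (HiddenDD-++ʳ (lo ∷ β) d))
      (Avoid213-⊆ (Sublist.++⁺ʳ (lo ∷ β) ⊆-refl) avoid) (λ e → noDD (HiddenEnd⇒DD β (aboveStart A p A≢lo) e)))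

record Coding {C : Set} (Valid : C → Set) (P : Pred (List ℕ) 0ℓ) : Set where
  field
    decode        : C → List ℕ
    encode        : List ℕ → C
    decode-sound  : ∀ {t} → Valid t → P (decode t)
    encode-valid  : ∀ {w} → P w → Valid (encode w)
    encode-decode : ∀ {t} → Valid t → encode (decode t) ≡ t
    decode-encode : ∀ {w} → P w → decode (encode w) ≡ w

codings⇒bijection : ∀ {C : Set} {Valid : C → Set} {P Q : Pred (List ℕ) 0ℓ} →
  Coding Valid P → Coding Valid Q → Bijection P Q
codings⇒bijection {P = P} {Q} cP cQ = f , g , forth , back
  where
  module P = Coding cP
  module Q = Coding cQ
  f g : List ℕ → List ℕ
  f w = Q.decode (P.encode w)
  g w = P.decode (Q.encode w)
  forth : ∀ w → P w → Q (f w) × g (f w) ≡ w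
  forth w Pw = Q.decode-sound (P.encode-valid Pw) ,
    trans (cong P.decode (Q.encode-decode (P.encode-valid Pw))) (P.decode-encode Pw)
  back : ∀ w → Q w → P (g w) × f (g w) ≡ w
  back w Qw = P.decode-sound (Q.encode-valid Qw) ,
    trans (cong Q.decode (P.encode-decode (Q.encode-valid Qw))) (Q.decode-encode Qw)

isPerm⇒rangePerm : ∀ {n w} → IsPerm n w → RangePerm 0 n w
isPerm⇒rangePerm {n} {w} = subst (w ↭_) (upTo≡range n)

rangePerm⇒isPerm : ∀ {n w} → RangePerm 0 n w → IsPerm n w
rangePerm⇒isPerm {n} {w} = subst (w ↭_) (sym (upTo≡range n))

coding231 : ∀ n → Coding (λ t → size t ≡ n) (RS n (1 ∷ 2 ∷ 0 ∷ []))
coding231 n = record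
  { decode        = word231 0
  ; encode        = λ w → code231 (length w) 0 w
  ; decode-sound  = sound
  ; encode-valid  = valid
  ; encode-decode = λ {t} _ → code231-word231 _ 0 t (≤-reflexive (sym (rangePerm-length (word231-perm 0 t))))
  ; decode-encode = decoded
  }
  where
  sound : ∀ {t} → size t ≡ n → RS n (1 ∷ 2 ∷ 0 ∷ []) (word231 0 t)
  sound {t} refl = rangePerm⇒isPerm (word231-perm 0 t) , noHiddenDD⇒simsun (proj₁ (word231-sound 0 t)) , Avoid231⇒avoids (proj₂ (word231-sound 0 t))
  decoded : ∀ {w} → RS n (1 ∷ 2 ∷ 0 ∷ []) w → word231 0 (code231 (length w) 0 w) ≡ w
  decoded {w} (perm , simsun , avoid) =
    word231-code231 (length w) 0 w ≤-refl (isPerm⇒rangePerm perm) (simsun⇒noHiddenDD simsun) (avoids⇒Avoid231 avoid)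
  valid : ∀ {w} → RS n (1 ∷ 2 ∷ 0 ∷ []) w → size (code231 (length w) 0 w) ≡ n
  valid {w} RSw = begin
    size t                ≡⟨ rangePerm-length (word231-perm 0 t) ⟨
    length (word231 0 t)  ≡⟨ cong length (decoded RSw) ⟩
    length w              ≡⟨ rangePerm-length (isPerm⇒rangePerm (proj₁ RSw)) ⟩
    n                     ∎
    where
    open ≡-Reasoning
    t : Tree
    t = code231 (length w) 0 w

coding213 : ∀ n → Coding (λ t → size t ≡ n) (RS n (1 ∷ 0 ∷ 2 ∷ []))
coding213 n = record
  { decode        = word213 0
  ; encode        = λ w → code213 (length w) 0 w
  ; decode-sound  = sound
  ; encode-valid  = valid
  ; encode-decode = λ {t} _ → code213-word213 _ 0 t (≤-reflexive (sym (rangePerm-length (word213-perm 0 t))))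
  ; decode-encode = decoded
  }
  where
  sound : ∀ {t} → size t ≡ n → RS n (1 ∷ 0 ∷ 2 ∷ []) (word213 0 t)
  sound {t} refl = rangePerm⇒isPerm (word213-perm 0 t) , noHiddenDD⇒simsun (proj₁ (word213-sound 0 t)) , Avoid213⇒avoids (proj₂ (word213-sound 0 t))
  decoded : ∀ {w} → RS n (1 ∷ 0 ∷ 2 ∷ []) w → word213 0 (code213 (length w) 0 w) ≡ w
  decoded {w} (perm , simsun , avoid) =
    word213-code213 (length w) 0 w ≤-refl (isPerm⇒rangePerm perm) (simsun⇒noHiddenDD simsun) (avoids⇒Avoid213 avoid)
  valid : ∀ {w} → RS n (1 ∷ 0 ∷ 2 ∷ []) w → size (code213 (length w) 0 w) ≡ n
  valid {w} RSw = begin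
    size t                ≡⟨ rangePerm-length (word213-perm 0 t) ⟨
    length (word213 0 t)  ≡⟨ cong length (decoded RSw) ⟩
    length w              ≡⟨ rangePerm-length (isPerm⇒rangePerm (proj₁ RSw)) ⟩
    n                     ∎
    where
    open ≡-Reasoning
    t : Tree
    t = code213 (length w) 0 w

-- Theorem 3.8.
theorem3p8 : ∀ (n : ℕ) → n ≥ 1 →
    Bijection (RS n (1 ∷ 2 ∷ 0 ∷ [])) (RS n (1 ∷ 0 ∷ 2 ∷ []))
theorem3p8 n _ = codings⇒bijection (coding231 n) (coding213 n)
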